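{- Consider black/white Mastermind with $n$ positions, color set $C$ containing the color $1$, and secret code $z\in C^n$; let $C^*=\{z_i: i\in[n]\}$ and, for $X\subseteq C$, let $\mathrm{col}(X)=|C^*\cap X|$. There is a single initial query $q_0\in C^n$ such that for every set $X\subseteq C$ with $|X|\le n$ there is a query $q_X\in C^n$ for which $\mathrm{col}(X)$ can be computed from $X$ and the black/white answers to $q_0$ and $q_X$. (Thus, after one initial query, Codebreaker can learn $\mathrm{col}(X)$ for any such $X$ with a single black/white query.)
   Context: In black/white Mastermind, for a guess $x\in C^n$ Codemaker reveals $\mathrm{eq}(z,x)=|\{i: z_i=x_i\}|$ (black pegs) and $\pi(z,x)=\max_{\rho\in S_n}|\{i: z_i=x_{\rho(i)}\}|-\mathrm{eq}(z,x)$ (white pegs), where $S_n$ is the set of permutations of $[n]$. -}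

module Defs where

open import Data.Nat using (ℕ; _≤_; _∸_)
open import Data.Product using (Σ; ∃; _×_)
open import Data.Fin using (Fin; _≟_)
open import Data.Fin.Subset using (Subset; _∩_; ∣_∣)
open import Data.Fin.Permutation using (Permutation′; _⟨$⟩ʳ_)
open import Data.Fin.Properties using (any?)
open import Data.List using (length; filter; allFin)
open import Data.Vec using (tabulate)
open import Relation.Nullary using (does)
open import Relation.Binary.PropositionalEquality using (_≡_)

Code : ℕ → ℕ → Set
Code n k = Fin n → Fin k

eqc : ∀ {n k} → Code n k → Code n k → ℕ
eqc {n} z x = length (filter (λ i → z i ≟ x i) (allFin n))

matchesUnder : ∀ {n k} → Code n k → Code n k → Permutation′ n → ℕ
matchesUnder {n} z x ρ = length (filter (λ i → z i ≟ x (ρ ⟨$⟩ʳ i)) (allFin n))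

IsMaxMatch : ∀ {n k} → Code n k → Code n k → ℕ → Set
IsMaxMatch {n} z x m =
  (∃ λ (ρ : Permutation′ n) → matchesUnder z x ρ ≡ m)
  × (∀ (ρ : Permutation′ n) → matchesUnder z x ρ ≤ m)

IsWhite : ∀ {n k} → Code n k → Code n k → ℕ → Set
IsWhite z x w = ∃ λ m → IsMaxMatch z x m × w ≡ m ∸ eqc z x

Answer : ∀ {n k} → Code n k → Code n k → ℕ → ℕ → Set
Answer z x b w = b ≡ eqc z x × IsWhite z x w

Cstar : ∀ {n k} → Code n k → Subset k
Cstar {n} z = tabulate (λ c → does (any? (λ i → z i ≟ c)))

col : ∀ {n k} → Code n k → Subset k → ℕ
col z X = ∣ Cstar z ∩ X ∣

module Submission where

-- For any codes z and x, black + white = Σ_c min(#c in z, #c in x): while a permutation ρ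
-- matches fewer than min(#c in z, #c in x) positions of some colour c, there is an unmatched
-- position of z of colour c and an unmatched position facing c, and transposing them gains a
-- match.  Take q₀ = 1ⁿ, whose black pegs count m₁ = #1 in z, and let q_X show every colour of
-- X ∖ {1} once and colour 1 elsewhere.  Then the second answer gives b + w =
-- min(m₁, n − |X ∖ {1}|) + |C* ∩ (X ∖ {1})|, while col(X) = min(m₁, [1 ∈ X]) + |C* ∩ (X ∖ {1})|.

open import Defs
open import Data.Bool using (Bool; true; false; _∧_)
open import Data.Bool.Properties using (∧-identityʳ; ∧-zeroʳ)
open import Data.Empty using (⊥-elim)
open import Data.Fin using (Fin; zero; suc; punchIn; _≟_)
open import Data.Fin.Permutation using (Permutation′; _⟨$⟩ʳ_; transpose; _∘ₚ_)
import Data.Fin.Permutation as Perm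
import Data.Fin.Permutation.Components as PC
open import Data.Fin.Subset using (Subset; ∣_∣; _∩_)
open import Data.Fin.Subset.Properties using (∣p∣≤∣x∷p∣)
open import Data.Fin.Properties using (any?)
open import Data.Vec using (Vec; []; _∷_; lookup; map; replicate; padRight)
open import Data.Vec.Properties using (lookup-zipWith; lookup∘tabulate)
open import Data.List using (length; filter; tabulate)
open import Data.Nat using (ℕ; zero; suc; _+_; _*_; _∸_; _⊓_; _≤_; _<_; z≤n; s≤s)
open import Data.Nat.Properties hiding (_≟_)
open import Data.Product using (Σ; ∃; ∃₂; _×_; _,_; proj₂)
open import Function using (_∘_)
open import Relation.Binary.PropositionalEquality
open import Relation.Nullary using (Dec; does; ¬_; yes; no)
open import Relation.Unary using (Pred; Decidable; _⊆_)
open import Relation.Unary.Properties using (_∩?_)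

open import Algebra.Properties.CommutativeMonoid.Sum +-0-commutativeMonoid
  using (sum; sum-syntax; sum-cong-≗; sum-remove; sum-permute; ∑-comm; sum-replicate-zero)

sum-mono-≤ : ∀ {n} {f g : Fin n → ℕ} → (∀ i → f i ≤ g i) → sum f ≤ sum g
sum-mono-≤ {zero}  f≤g = z≤n
sum-mono-≤ {suc n} f≤g = +-mono-≤ (f≤g zero) (sum-mono-≤ (f≤g ∘ suc))

sum-mono-< : ∀ {n} {f g : Fin n → ℕ} → (∀ i → f i ≤ g i) → ∀ a → f a < g a → sum f < sum g
sum-mono-< {suc n} {f} {g} f≤g a fa<ga = begin-strict
  sum f                        ≡⟨ sum-remove {i = a} f ⟩
  f a + sum (f ∘ punchIn a)    <⟨ +-mono-<-≤ fa<ga (sum-mono-≤ (f≤g ∘ punchIn a)) ⟩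
  g a + sum (g ∘ punchIn a)    ≡⟨ sum-remove {i = a} g ⟨
  sum g                        ∎
  where open ≤-Reasoning

sum-<⇒∃< : ∀ {n} (f g : Fin n → ℕ) → sum f < sum g → ∃ λ i → f i < g i
sum-<⇒∃< {suc n} f g lt with f zero <? g zero
... | yes f₀<g₀ = zero , f₀<g₀
... | no  f₀≮g₀ =
  let i , fi<gi = sum-<⇒∃< (f ∘ suc) (g ∘ suc)
                    (+-cancelˡ-< _ _ _ (<-≤-trans lt (+-monoˡ-≤ _ (≮⇒≥ f₀≮g₀))))
  in suc i , fi<gi

𝟙 : Bool → ℕ
𝟙 true  = 1
𝟙 false = 0

𝟙-mono : ∀ {a b} {A : Set a} {B : Set b} → (A → B) → (A? : Dec A) (B? : Dec B) → 𝟙 (does A?) ≤ 𝟙 (does B?)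
𝟙-mono A⇒B (no _)  _       = z≤n
𝟙-mono A⇒B (yes _) (yes _) = ≤-refl
𝟙-mono A⇒B (yes a) (no ¬b) = ⊥-elim (¬b (A⇒B a))

module _ {n : ℕ} where

  count : ∀ {p} {P : Pred (Fin n) p} → Decidable P → ℕ
  count P? = ∑[ i < n ] 𝟙 (does (P? i))

  module _ {p q} {P : Pred (Fin n) p} {Q : Pred (Fin n) q} (P? : Decidable P) (Q? : Decidable Q) where

    count-mono : P ⊆ Q → count P? ≤ count Q?
    count-mono P⊆Q = sum-mono-≤ (λ i → 𝟙-mono P⊆Q (P? i) (Q? i))

    count-mono-< : P ⊆ Q → ∀ a → ¬ P a → Q a → count P? < count Q?
    count-mono-< P⊆Q a ¬Pa Qa = sum-mono-< (λ i → 𝟙-mono P⊆Q (P? i) (Q? i)) a 𝟙-<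
      where
      𝟙-< : 𝟙 (does (P? a)) < 𝟙 (does (Q? a))
      𝟙-< with P? a | Q? a
      ... | no _   | yes _  = s≤s z≤n
      ... | yes Pa | _      = ⊥-elim (¬Pa Pa)
      ... | _      | no ¬Qa = ⊥-elim (¬Qa Qa)

    count-<⇒∃ : count P? < count Q? → ∃ λ i → Q i × ¬ P i
    count-<⇒∃ lt with sum-<⇒∃< (𝟙 ∘ does ∘ P?) (𝟙 ∘ does ∘ Q?) lt
    ... | i , 𝟙-< with P? i | Q? i
    ...   | no ¬Pi | yes Qi = i , Qi , ¬Pi
    ...   | yes _  | yes _  = ⊥-elim (<-irrefl refl 𝟙-<)

  count-permute : ∀ {p} {P : Pred (Fin n) p} (P? : Decidable P) (ρ : Permutation′ n) →
                  count (P? ∘ (ρ ⟨$⟩ʳ_)) ≡ count P?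
  count-permute P? ρ = sym (sum-permute (𝟙 ∘ does ∘ P?) ρ)

  count-∅ : ∀ {p} {P : Pred (Fin n) p} (P? : Decidable P) → (∀ i → ¬ P i) → count P? ≡ 0
  count-∅ P? ∅ = trans (sum-cong-≗ 𝟙-no) (sum-replicate-zero n)
    where
    𝟙-no : ∀ i → 𝟙 (does (P? i)) ≡ 0
    𝟙-no i with P? i
    ... | yes Pi = ⊥-elim (∅ i Pi)
    ... | no  _  = refl

count-≟ : ∀ {n} (a : Fin n) → count (a ≟_) ≡ 1
count-≟ {suc n} zero    = cong suc (count-∅ {n} (λ c → zero ≟ suc c) (λ _ ()))
count-≟ {suc n} (suc a) = count-≟ a

count-fibres : ∀ {n k p} {P : Pred (Fin n) p} (P? : Decidable P) (f : Fin n → Fin k) →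
               count P? ≡ ∑[ c < k ] count (P? ∩? λ i → f i ≟ c)
count-fibres {n} {k} P? f = begin
  ∑[ i < n ] 𝟙 (does (P? i))                                    ≡⟨ sum-cong-≗ (λ i → sym (𝟙-fibres i)) ⟩
  ∑[ i < n ] ∑[ c < k ] 𝟙 (does ((P? ∩? λ j → f j ≟ c) i))      ≡⟨ ∑-comm (λ i c → 𝟙 (does ((P? ∩? λ j → f j ≟ c) i))) ⟩
  ∑[ c < k ] ∑[ i < n ] 𝟙 (does ((P? ∩? λ j → f j ≟ c) i))      ∎
  where
  open ≡-Reasoning
  𝟙-fibres : ∀ i → ∑[ c < k ] 𝟙 (does ((P? ∩? λ j → f j ≟ c) i)) ≡ 𝟙 (does (P? i))
  𝟙-fibres i with P? i
  ... | yes _ = count-≟ (f i)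
  ... | no  _ = sum-replicate-zero k

length-filter-tabulate : ∀ {a p} {A : Set a} {P : Pred A p} (P? : Decidable P) {n} (f : Fin n → A) →
                         length (filter P? (tabulate f)) ≡ count (P? ∘ f)
length-filter-tabulate P? {zero}  f = refl
length-filter-tabulate P? {suc n} f with does (P? (f zero))
... | true  = cong suc (length-filter-tabulate P? (f ∘ suc))
... | false = length-filter-tabulate P? (f ∘ suc)

transpose-matchˡ : ∀ {n} (i j : Fin n) → PC.transpose i j i ≡ j
transpose-matchˡ i j with i ≟ i
... | yes _   = refl
... | no  i≢i = ⊥-elim (i≢i refl)

transpose-fix : ∀ {n} {i j t : Fin n} → t ≢ i → t ≢ j → PC.transpose i j t ≡ t
transpose-fix {i = i} {j} {t} t≢i t≢j with t ≟ i
... | yes t≡i = ⊥-elim (t≢i t≡i)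
... | no  _ with t ≟ j
...   | yes t≡j = ⊥-elim (t≢j t≡j)
...   | no  _   = refl

module _ {n k : ℕ} where

  multiplicity : Code n k → Fin k → ℕ
  multiplicity z c = count (λ i → z i ≟ c)

  agrees? : (z x : Code n k) (ρ : Permutation′ n) → Decidable (λ i → z i ≡ x (ρ ⟨$⟩ʳ i))
  agrees? z x ρ i = z i ≟ x (ρ ⟨$⟩ʳ i)

  matches : Code n k → Code n k → Permutation′ n → ℕ
  matches z x ρ = count (agrees? z x ρ)

  matchesOfColour : Code n k → Code n k → Permutation′ n → Fin k → ℕ
  matchesOfColour z x ρ c = count (agrees? z x ρ ∩? λ i → z i ≟ c)

  common : Code n k → Code n k → ℕ
  common z x = ∑[ c < k ] (multiplicity z c ⊓ multiplicity x c)

  matches≤common : ∀ z x ρ → matches z x ρ ≤ common z x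
  matches≤common z x ρ = begin
    matches z x ρ                       ≡⟨ count-fibres (agrees? z x ρ) z ⟩
    ∑[ c < k ] matchesOfColour z x ρ c  ≤⟨ sum-mono-≤ (λ c → ⊓-glb (≤multiplicityˡ c)
                                                                   (≤multiplicityʳ c)) ⟩
    common z x                          ∎
    where
    open ≤-Reasoning
    ≤multiplicityˡ : ∀ c → matchesOfColour z x ρ c ≤ multiplicity z c
    ≤multiplicityˡ c = count-mono (agrees? z x ρ ∩? λ i → z i ≟ c) (λ i → z i ≟ c) proj₂
    ≤multiplicityʳ : ∀ c → matchesOfColour z x ρ c ≤ multiplicity x c
    ≤multiplicityʳ c = begin
      matchesOfColour z x ρ c          ≤⟨ count-mono (agrees? z x ρ ∩? λ i → z i ≟ c) (λ i → x (ρ ⟨$⟩ʳ i) ≟ c)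
                                                     (λ (zi≡xρi , zi≡c) → trans (sym zi≡xρi) zi≡c) ⟩
      count (λ i → x (ρ ⟨$⟩ʳ i) ≟ c)   ≡⟨ count-permute (λ j → x j ≟ c) ρ ⟩
      multiplicity x c                 ∎

  matches-transpose : ∀ z x ρ {i j} →
                      z i ≢ x (ρ ⟨$⟩ʳ i) → z j ≢ x (ρ ⟨$⟩ʳ j) → z i ≡ x (ρ ⟨$⟩ʳ j) →
                      matches z x ρ < matches z x (transpose i j ∘ₚ ρ)
  matches-transpose z x ρ {i} {j} i-unmatched j-unmatched zi≡xρj =
    count-mono-< (agrees? z x ρ) (agrees? z x ρ′) stays-matched i i-unmatched
      (trans zi≡xρj (cong (λ s → x (ρ ⟨$⟩ʳ s)) (sym (transpose-matchˡ i j))))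
    where
    ρ′ = transpose i j ∘ₚ ρ
    stays-matched : ∀ {t} → z t ≡ x (ρ ⟨$⟩ʳ t) → z t ≡ x (ρ′ ⟨$⟩ʳ t)
    stays-matched {t} zt≡xρt =
      trans zt≡xρt (cong (λ s → x (ρ ⟨$⟩ʳ s))
                         (sym (transpose-fix (λ { refl → i-unmatched zt≡xρt }) (λ { refl → j-unmatched zt≡xρt }))))

  matchesUnder≡matches : ∀ z x ρ → matchesUnder z x ρ ≡ matches z x ρ
  matchesUnder≡matches z x ρ = length-filter-tabulate (agrees? z x ρ) (λ i → i)

  unmatched-pair : ∀ z x ρ c → matchesOfColour z x ρ c < multiplicity z c ⊓ multiplicity x c →
                   ∃₂ λ i j → z i ≢ x (ρ ⟨$⟩ʳ i) × z j ≢ x (ρ ⟨$⟩ʳ j) × z i ≡ x (ρ ⟨$⟩ʳ j)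
  unmatched-pair z x ρ c fewer
    with count-<⇒∃ (agrees? z x ρ ∩? λ i → z i ≟ c) (λ i → z i ≟ c) (m<n⊓o⇒m<n _ _ fewer)
       | count-<⇒∃ (agrees? z x ρ ∩? λ i → z i ≟ c) (λ j → x (ρ ⟨$⟩ʳ j) ≟ c)
           (subst (matchesOfColour z x ρ c <_) (sym (count-permute (λ j → x j ≟ c) ρ))
                  (m<n⊓o⇒m<o _ _ fewer))
  ... | i , zi≡c , ¬i | j , xρj≡c , ¬j =
    i , j , (λ ag → ¬i (ag , zi≡c)) , (λ ag → ¬j (ag , trans ag xρj≡c)) , trans zi≡c (sym xρj≡c)

  matches-improvable : ∀ z x ρ → matches z x ρ < common z x →
                       ∃ λ ρ′ → matches z x ρ < matches z x ρ′
  matches-improvable z x ρ lt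
    with sum-<⇒∃< (matchesOfColour z x ρ) _
           (subst (_< common z x) (count-fibres (agrees? z x ρ) z) lt)
  ... | c , fewer with unmatched-pair z x ρ c fewer
  ...   | i , j , i-unmatched , j-unmatched , zi≡xρj =
    transpose i j ∘ₚ ρ , matches-transpose z x ρ i-unmatched j-unmatched zi≡xρj

  common-attained : ∀ z x → ∃ λ ρ → common z x ≤ matches z x ρ
  common-attained z x = climb (common z x) Perm.id (m∸n≤m (common z x) (matches z x Perm.id))
    where
    climb : ∀ fuel ρ → common z x ∸ matches z x ρ ≤ fuel → ∃ λ ρ → common z x ≤ matches z x ρ
    climb zero       ρ gap≤0 = ρ , m∸n≡0⇒m≤n {common z x} {matches z x ρ} (n≤0⇒n≡0 gap≤0)
    climb (suc fuel) ρ gap≤ with common z x ≤? matches z x ρ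
    ... | yes done = ρ , done
    ... | no  ¬done =
      let ρ′ , better = matches-improvable z x ρ (≰⇒> ¬done)
          gap-shrinks = ∸-monoʳ-< {common z x} {matches z x ρ′} {matches z x ρ} better (matches≤common z x ρ′)
      in climb fuel ρ′ (≤-pred (<-≤-trans gap-shrinks gap≤))

  isMaxMatch⇒≡common : ∀ {z x m} → IsMaxMatch z x m → m ≡ common z x
  isMaxMatch⇒≡common {z} {x} ((ρ , ρ-attains) , maximal) with common-attained z x
  ... | ρ* , ρ*-attains = ≤-antisym
    (subst (_≤ common z x) (trans (sym (matchesUnder≡matches z x ρ)) ρ-attains) (matches≤common z x ρ))
    (≤-trans ρ*-attains (subst (_≤ _) (matchesUnder≡matches z x ρ*) (maximal ρ*)))

  black+white≡common : ∀ {z x b w} → Answer z x b w → b + w ≡ common z x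
  -- `maximal Perm.id` bounds eqc z x, which is matchesUnder z x Perm.id by definition.
  black+white≡common {z} {x} (refl , m , max@(_ , maximal) , refl) = begin
    eqc z x + (m ∸ eqc z x)  ≡⟨ m+[n∸m]≡n {eqc z x} {m} (maximal Perm.id) ⟩
    m                        ≡⟨ isMaxMatch⇒≡common {z} {x} max ⟩
    common z x               ∎
    where open ≡-Reasoning

answer-constant : ∀ {n k} {z : Code n k} {c b w} → Answer z (λ _ → c) b w → b ≡ multiplicity z c
answer-constant {z = z} {c} (refl , _) = length-filter-tabulate (λ i → z i ≟ c) (λ i → i)

multiplicity-replicate : ∀ {k} n (a c : Fin k) →
                         multiplicity (lookup (replicate n a)) c ≡ n * 𝟙 (does (a ≟ c))
multiplicity-replicate zero    a c = refl
multiplicity-replicate (suc n) a c = cong (𝟙 (does (a ≟ c)) +_) (multiplicity-replicate n a c)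

multiplicity-padRight : ∀ {k m n} (m≤n : m ≤ n) (a : Fin k) (xs : Vec (Fin k) m) (c : Fin k) →
                        multiplicity (lookup (padRight m≤n a xs)) c
                          ≡ multiplicity (lookup xs) c + (n ∸ m) * 𝟙 (does (a ≟ c))
multiplicity-padRight {n = n} z≤n a []       c = multiplicity-replicate n a c
multiplicity-padRight (s≤s m≤n) a (x ∷ xs) c =
  trans (cong (𝟙 (does (x ≟ c)) +_) (multiplicity-padRight m≤n a xs c))
        (sym (+-assoc (𝟙 (does (x ≟ c))) _ _))

multiplicity-map-suc : ∀ {k m} (xs : Vec (Fin k) m) (c : Fin k) →
                       multiplicity (lookup (map suc xs)) (suc c) ≡ multiplicity (lookup xs) c
multiplicity-map-suc []       c = refl
multiplicity-map-suc (x ∷ xs) c = cong (𝟙 (does (x ≟ c)) +_) (multiplicity-map-suc xs c)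

multiplicity-map-suc-zero : ∀ {k m} (xs : Vec (Fin k) m) → multiplicity (lookup (map suc xs)) zero ≡ 0
multiplicity-map-suc-zero []       = refl
multiplicity-map-suc-zero (x ∷ xs) = multiplicity-map-suc-zero xs

members : ∀ {k} (p : Subset k) → Vec (Fin k) ∣ p ∣
members []          = []
members (true ∷ p)  = zero ∷ map suc (members p)
members (false ∷ p) = map suc (members p)

multiplicity-members : ∀ {k} (p : Subset k) (c : Fin k) →
                       multiplicity (lookup (members p)) c ≡ 𝟙 (lookup p c)
multiplicity-members (true  ∷ p) zero    = cong suc (multiplicity-map-suc-zero (members p))
multiplicity-members (false ∷ p) zero    = multiplicity-map-suc-zero (members p)
multiplicity-members (true  ∷ p) (suc c) = trans (multiplicity-map-suc (members p) c) (multiplicity-members p c)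
multiplicity-members (false ∷ p) (suc c) = trans (multiplicity-map-suc (members p) c) (multiplicity-members p c)

-- The paper's colour 1 is `zero`, and X = x₀ ∷ X′ with X′ the colours of X other than 1.
module _ {n k : ℕ} (X′ : Subset k) (∣X′∣≤n : ∣ X′ ∣ ≤ n) where

  query : Code n (suc k)
  query = lookup (padRight ∣X′∣≤n zero (map suc (members X′)))

  multiplicity-query-zero : multiplicity query zero ≡ n ∸ ∣ X′ ∣
  multiplicity-query-zero = begin
    multiplicity query zero
      ≡⟨ multiplicity-padRight ∣X′∣≤n zero _ zero ⟩
    multiplicity (lookup (map suc (members X′))) zero + (n ∸ ∣ X′ ∣) * 1
      ≡⟨ cong₂ _+_ (multiplicity-map-suc-zero (members X′)) (*-identityʳ (n ∸ ∣ X′ ∣)) ⟩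
    n ∸ ∣ X′ ∣
      ∎
    where open ≡-Reasoning

  multiplicity-query-suc : ∀ c → multiplicity query (suc c) ≡ 𝟙 (lookup X′ c)
  multiplicity-query-suc c = begin
    multiplicity query (suc c)
      ≡⟨ multiplicity-padRight ∣X′∣≤n zero _ (suc c) ⟩
    multiplicity (lookup (map suc (members X′))) (suc c) + (n ∸ ∣ X′ ∣) * 0
      ≡⟨ cong₂ _+_ (multiplicity-map-suc (members X′) c) (*-zeroʳ (n ∸ ∣ X′ ∣)) ⟩
    multiplicity (lookup (members X′)) c + 0
      ≡⟨ +-identityʳ _ ⟩
    multiplicity (lookup (members X′)) c
      ≡⟨ multiplicity-members X′ c ⟩
    𝟙 (lookup X′ c)
      ∎
    where open ≡-Reasoning

  common-query : ∀ z → common z query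
                 ≡ multiplicity z zero ⊓ (n ∸ ∣ X′ ∣) + ∑[ c < k ] (multiplicity z (suc c) ⊓ 𝟙 (lookup X′ c))
  common-query z = cong₂ _+_ (cong (multiplicity z zero ⊓_) multiplicity-query-zero)
                             (sum-cong-≗ (λ c → cong (multiplicity z (suc c) ⊓_) (multiplicity-query-suc c)))

𝟙-any? : ∀ {n p} {P : Pred (Fin n) p} (P? : Decidable P) → 𝟙 (does (any? P?)) ≡ count P? ⊓ 1
𝟙-any? {n} P? with any? P?
... | yes (i , Pi) =
  sym (m≥n⇒m⊓n≡n (subst (_< count P?) (sum-replicate-zero n) (sum-mono-< (λ _ → z≤n) i 𝟙-Pi)))
  where
  𝟙-Pi : 0 < 𝟙 (does (P? i))
  𝟙-Pi with P? i
  ... | yes _  = s≤s z≤n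
  ... | no ¬Pi = ⊥-elim (¬Pi Pi)
... | no ¬∃P = cong (_⊓ 1) (sym (count-∅ P? (λ i Pi → ¬∃P (i , Pi))))

∣p∣≡∑𝟙 : ∀ {k} (p : Subset k) → ∣ p ∣ ≡ ∑[ c < k ] 𝟙 (lookup p c)
∣p∣≡∑𝟙 []          = refl
∣p∣≡∑𝟙 (true  ∷ p) = cong suc (∣p∣≡∑𝟙 p)
∣p∣≡∑𝟙 (false ∷ p) = ∣p∣≡∑𝟙 p

col≡∑multiplicity⊓𝟙 : ∀ {n k} (z : Code n k) (X : Subset k) →
                      col z X ≡ ∑[ c < k ] (multiplicity z c ⊓ 𝟙 (lookup X c))
col≡∑multiplicity⊓𝟙 {k = k} z X = trans (∣p∣≡∑𝟙 (Cstar z ∩ X)) (sum-cong-≗ 𝟙-present-in)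
  where
  present : Fin k → Bool
  present c = does (any? (λ i → z i ≟ c))
  𝟙-∧ : ∀ m a b → 𝟙 a ≡ m ⊓ 1 → 𝟙 (a ∧ b) ≡ m ⊓ 𝟙 b
  𝟙-∧ m a true  𝟙a = trans (cong 𝟙 (∧-identityʳ a)) 𝟙a
  𝟙-∧ m a false _  = trans (cong 𝟙 (∧-zeroʳ a)) (sym (⊓-zeroʳ m))
  𝟙-present-in : ∀ c → 𝟙 (lookup (Cstar z ∩ X) c) ≡ multiplicity z c ⊓ 𝟙 (lookup X c)
  𝟙-present-in c = begin
    𝟙 (lookup (Cstar z ∩ X) c)
      ≡⟨ cong 𝟙 (lookup-zipWith _∧_ c (Cstar z) X) ⟩
    𝟙 (lookup (Cstar z) c ∧ lookup X c)
      ≡⟨ cong (λ a → 𝟙 (a ∧ lookup X c)) (lookup∘tabulate present c) ⟩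
    𝟙 (present c ∧ lookup X c)
      ≡⟨ 𝟙-∧ (multiplicity z c) (present c) (lookup X c) (𝟙-any? (λ i → z i ≟ c)) ⟩
    multiplicity z c ⊓ 𝟙 (lookup X c)
      ∎
    where open ≡-Reasoning

decode : ∀ {n k} → Bool → Subset k → ℕ × ℕ → ℕ × ℕ → ℕ
decode {n} x₀ X′ (b₀ , _) (b , w) = b₀ ⊓ 𝟙 x₀ + (b + w ∸ b₀ ⊓ (n ∸ ∣ X′ ∣))

col≡decode : ∀ {n k} (x₀ : Bool) (X′ : Subset k) (∣X′∣≤n : ∣ X′ ∣ ≤ n) (z : Code n (suc k)) {b₀ w₀ b w} →
             Answer z (λ _ → zero) b₀ w₀ → Answer z (query X′ ∣X′∣≤n) b w →
             col z (x₀ ∷ X′) ≡ decode {n} x₀ X′ (b₀ , w₀) (b , w)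
col≡decode {n} {k} x₀ X′ ∣X′∣≤n z {b₀} {b = b} {w} ans₀ ans = begin
  col z (x₀ ∷ X′)
    ≡⟨ col≡∑multiplicity⊓𝟙 z (x₀ ∷ X′) ⟩
  m₁ ⊓ 𝟙 x₀ + rest
    ≡⟨ cong (m₁ ⊓ 𝟙 x₀ +_) (m+n∸m≡n (m₁ ⊓ (n ∸ ∣ X′ ∣)) rest) ⟨
  m₁ ⊓ 𝟙 x₀ + (m₁ ⊓ (n ∸ ∣ X′ ∣) + rest ∸ m₁ ⊓ (n ∸ ∣ X′ ∣))
    ≡⟨ cong₂ (λ m₁ b+w → m₁ ⊓ 𝟙 x₀ + (b+w ∸ m₁ ⊓ (n ∸ ∣ X′ ∣)))
             (sym (answer-constant ans₀))
             (sym (trans (black+white≡common ans) (common-query X′ ∣X′∣≤n z))) ⟩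
  b₀ ⊓ 𝟙 x₀ + (b + w ∸ b₀ ⊓ (n ∸ ∣ X′ ∣))
    ∎
  where
  open ≡-Reasoning
  m₁ = multiplicity z zero
  rest = ∑[ c < k ] (multiplicity z (suc c) ⊓ 𝟙 (lookup X′ c))

lemma7 : ∀ (n k : ℕ) → 1 ≤ k →
    Σ (Code n k) λ q₀ →
      ∀ (X : Subset k) → ∣ X ∣ ≤ n →
        Σ (Code n k) λ q_X →
          Σ (ℕ × ℕ → ℕ × ℕ → ℕ) λ f →
            ∀ (z : Code n k) (b₀ w₀ b w : ℕ) →
              Answer z q₀ b₀ w₀ → Answer z q_X b w →
              col z X ≡ f (b₀ , w₀) (b , w)
lemma7 n (suc k) _ = (λ _ → zero) , λ where
  (x₀ ∷ X′) ∣X∣≤n →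
    let ∣X′∣≤n = ≤-trans (∣p∣≤∣x∷p∣ x₀ X′) ∣X∣≤n in
    query X′ ∣X′∣≤n , decode {n} x₀ X′ , λ z _ _ _ _ → col≡decode x₀ X′ ∣X′∣≤n z
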